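{- Let $\mathcal{F} \subset \mathcal{P}([n])$ be an $r$-closed $\theta$-intersecting family, where $r \geq 3$ and $\theta \in (0,1)$. Then for every $i$ with $\mathcal{F}(i) \neq \emptyset$, the family $\mathcal{F}(i)$ is a sunflower.
   Context: A family $\mathcal{F} \subset \mathcal{P}([n])$ is $r$-closed $\theta$-intersecting if for each $2 \leq t \leq r$ and any $t$ distinct sets $A_1,\dots,A_t \in \mathcal{F}$ we have $|A_1 \cap \dots \cap A_t| \in \{\theta|A_1|, \dots, \theta|A_t|\}$. $\mathcal{F}(i) := \mathcal{F} \cap \binom{[n]}{i}$. A family $\mathcal{G}$ of subsets of $[n]$ is a sunflower if, with $C := \bigcap_{A \in \mathcal{G}} A$, we have $A \cap B = C$ for all distinct $A, B \in \mathcal{G}$.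
   Formalization: The parameter θ ranges over the rationals in the interval (0,1). -}

module Defs where

open import Data.Nat using (ℕ; _≟_)
open import Data.Integer using (+_)
open import Data.Rational using (ℚ; _/_; _*_)
open import Data.Fin using (Fin)
open import Data.Fin.Subset using (Subset; _∩_; ⊤; ∣_∣; ⋂)
open import Data.List using (List; filter; map; tabulate)
open import Data.List.Membership.Propositional using (_∈_)
open import Data.Product using (∃)
open import Function.Definitions using (Injective)
open import Relation.Binary.PropositionalEquality using (_≡_; _≢_)

ℕ→ℚ : ℕ → ℚ
ℕ→ℚ k = (+ k) / 1

⋂ᵢ : ∀ {n t} → (Fin t → Subset n) → Subset n
⋂ᵢ {t = t} A = ⋂ (tabulate A)

-- A family of subsets of [n] is a duplicate-free list (the duplicate-freeness
-- is imposed separately as a hypothesis where needed).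
-- r-closed θ-intersecting: for each 2 ≤ t ≤ r and any t distinct members
-- A₁,…,A_t, |A₁ ∩ … ∩ A_t| ∈ {θ|A₁|, …, θ|A_t|}.
RClosedθIntersecting : ∀ {n} → ℕ → ℚ → List (Subset n) → Set
RClosedθIntersecting {n} r θ F =
  ∀ (t : ℕ) → 2 Data.Nat.≤ t → t Data.Nat.≤ r →
  (A : Fin t → Subset n) → Injective _≡_ _≡_ A → (∀ j → A j ∈ F) →
  ∃ λ (j : Fin t) → ℕ→ℚ ∣ ⋂ᵢ A ∣ ≡ θ * ℕ→ℚ ∣ A j ∣

layer : ∀ {n} → List (Subset n) → ℕ → List (Subset n)
layer F i = filter (λ A → ∣ A ∣ ≟ i) F

Sunflower : ∀ {n} → List (Subset n) → Set
Sunflower G = ∀ {A B} → A ∈ G → B ∈ G → A ≢ B → A ∩ B ≡ ⋂ G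

-- Two distinct members A, B of a layer F(i) and a third member C give an
-- admissible pair and triple, so |A ∩ B| = θ i = |(A ∩ B) ∩ C|. As (A ∩ B) ∩ C ⊆ A ∩ B,
-- equal cardinality forces A ∩ B ⊆ C; hence A ∩ B is contained in every member,
-- i.e. it is the kernel of the layer.
module Submission where

open import Defs
open import Data.Nat using (ℕ; _≥_; _≤_; s≤s; z≤n; _≟_)
open import Data.Nat.Properties using (*-identityʳ; ≤-reflexive; ≤⇒≯; ≤-trans)
open import Data.Rational using (ℚ; 0ℚ; 1ℚ; _<_; _*_)
open import Data.Rational.Properties using (normalize-injective-≃)
open import Data.Fin.Subset using (Subset; _∩_; ∣_∣; ⋂; _⊆_)
open import Data.Fin.Subset.Properties
  using (_∈?_; ⊆-trans; ⊆-antisym; p⊂q⇒∣p∣<∣q∣; p∩q⊆p; p∩q⊆q; x∈p∩q⁺; ∈⊤; ∩-assoc; ∩-identityʳ)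
open import Data.Vec using (Vec; []; _∷_; lookup)
open import Data.Vec.Properties using (≡-dec)
open import Data.Vec.Relation.Unary.All using (All; []; _∷_)
open import Data.Vec.Relation.Unary.AllPairs using ([]; _∷_)
open import Data.Vec.Relation.Unary.All.Properties using (lookup⁺)
open import Data.Vec.Relation.Unary.Unique.Propositional as VecUnique using ()
open import Data.Vec.Relation.Unary.Unique.Propositional.Properties using (lookup-injective)
import Data.Bool.Properties as Bool
open import Data.List using (List; []; _∷_)
open import Data.List.Membership.Propositional using (_∈_)
open import Data.List.Membership.Propositional.Properties using (∈-filter⁻)
open import Data.List.Relation.Unary.Any using (here; there)
open import Data.List.Relation.Unary.Unique.Propositional using (Unique)
open import Data.Product using (_,_; proj₁; proj₂)
open import Relation.Nullary using (yes; no; contradiction)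
open import Relation.Binary.PropositionalEquality
  using (_≡_; _≢_; refl; sym; trans; cong; module ≡-Reasoning)

ℕ→ℚ-injective : ∀ {a b} → ℕ→ℚ a ≡ ℕ→ℚ b → a ≡ b
ℕ→ℚ-injective {a} {b} eq =
  trans (sym (*-identityʳ a)) (trans (normalize-injective-≃ a b 1 1 eq) (*-identityʳ b))

module _ {n : ℕ} where

  ⊆∧∣∣≤⇒⊇ : {p q : Subset n} → p ⊆ q → ∣ q ∣ ≤ ∣ p ∣ → q ⊆ p
  ⊆∧∣∣≤⇒⊇ {p} p⊆q ∣q∣≤∣p∣ {x} x∈q with x ∈? p
  ... | yes x∈p = x∈p
  ... | no x∉p = contradiction (p⊂q⇒∣p∣<∣q∣ (p⊆q , x , x∈q , x∉p)) (≤⇒≯ ∣q∣≤∣p∣)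

  ∣p∩q∣≡∣p∣⇒p⊆q : (p q : Subset n) → ∣ p ∩ q ∣ ≡ ∣ p ∣ → p ⊆ q
  ∣p∩q∣≡∣p∣⇒p⊆q p q eq =
    ⊆-trans (⊆∧∣∣≤⇒⊇ (p∩q⊆p p q) (≤-reflexive (sym eq))) (p∩q⊆q p q)

  ⋂-lowerBound : ∀ {C} (G : List (Subset n)) → C ∈ G → ⋂ G ⊆ C
  ⋂-lowerBound (C ∷ G) (here refl) = p∩q⊆p C (⋂ G)
  ⋂-lowerBound (D ∷ G) (there C∈G) = ⊆-trans (p∩q⊆q D (⋂ G)) (⋂-lowerBound G C∈G)

  ⋂-greatest : ∀ {X} (G : List (Subset n)) → (∀ {C} → C ∈ G → X ⊆ C) → X ⊆ ⋂ G
  ⋂-greatest []      X⊆G x∈X = ∈⊤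
  ⋂-greatest (C ∷ G) X⊆G x∈X =
    x∈p∩q⁺ (X⊆G (here refl) x∈X , ⋂-greatest G (λ C∈G → X⊆G (there C∈G)) x∈X)

  ⋂-pair : (A B : Subset n) → ⋂ (A ∷ B ∷ []) ≡ A ∩ B
  ⋂-pair A B = cong (A ∩_) (∩-identityʳ B)

  ⋂-triple : (A B C : Subset n) → ⋂ (A ∷ B ∷ C ∷ []) ≡ (A ∩ B) ∩ C
  ⋂-triple A B C = trans (cong (λ X → A ∩ (B ∩ X)) (∩-identityʳ C)) (sym (∩-assoc A B C))

  StableTripleIntersections : List (Subset n) → Set
  StableTripleIntersections G =
    ∀ {A B C} → A ∈ G → B ∈ G → C ∈ G → A ≢ B → C ≢ A → C ≢ B → ∣ (A ∩ B) ∩ C ∣ ≡ ∣ A ∩ B ∣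

  stableTripleIntersections⇒sunflower : (G : List (Subset n)) →
    StableTripleIntersections G → Sunflower G
  stableTripleIntersections⇒sunflower G stable {A} {B} A∈G B∈G A≢B =
    ⊆-antisym (⋂-greatest G A∩B⊆) λ x∈⋂G →
      x∈p∩q⁺ (⋂-lowerBound G A∈G x∈⋂G , ⋂-lowerBound G B∈G x∈⋂G)
    where
    A∩B⊆ : ∀ {C} → C ∈ G → A ∩ B ⊆ C
    A∩B⊆ {C} C∈G with ≡-dec Bool._≟_ C A | ≡-dec Bool._≟_ C B
    ... | yes refl | _        = p∩q⊆p A B
    ... | no _     | yes refl = p∩q⊆q A B
    ... | no C≢A   | no C≢B   = ∣p∩q∣≡∣p∣⇒p⊆q (A ∩ B) C (stable A∈G B∈G C∈G A≢B C≢A C≢B)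

  module _ (F : List (Subset n)) {i : ℕ} {C : Subset n} (C∈ : C ∈ layer F i) where

    ∈-layer⇒∈ : C ∈ F
    ∈-layer⇒∈ = proj₁ (∈-filter⁻ (λ S → ∣ S ∣ ≟ i) {xs = F} C∈)

    ∈-layer⇒∣∣≡ : ∣ C ∣ ≡ i
    ∈-layer⇒∣∣≡ = proj₂ (∈-filter⁻ (λ S → ∣ S ∣ ≟ i) {xs = F} C∈)

  module _ {r : ℕ} {θ : ℚ} {F : List (Subset n)} (closed : RClosedθIntersecting r θ F) where

    layer-⋂-card : ∀ {i t} → 2 ≤ t → t ≤ r → (As : Vec (Subset n) t) →
      VecUnique.Unique As → All (_∈ layer F i) As →
      ℕ→ℚ ∣ ⋂ᵢ (lookup As) ∣ ≡ θ * ℕ→ℚ i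
    layer-⋂-card {i} 2≤t t≤r As distinct As∈ =
      let j , eq = closed _ 2≤t t≤r (lookup As)
                     (λ {j} {k} → lookup-injective distinct j k)
                     (λ j → ∈-layer⇒∈ F (lookup⁺ As∈ j))
      in trans eq (cong (λ k → θ * ℕ→ℚ k) (∈-layer⇒∣∣≡ F (lookup⁺ As∈ j)))

    layer-stableTripleIntersections : r ≥ 3 → ∀ i → StableTripleIntersections (layer F i)
    layer-stableTripleIntersections r≥3 i {A} {B} {C} A∈ B∈ C∈ A≢B C≢A C≢B = begin
      ∣ (A ∩ B) ∩ C ∣           ≡⟨ cong ∣_∣ (sym (⋂-triple A B C)) ⟩
      ∣ ⋂ (A ∷ B ∷ C ∷ []) ∣    ≡⟨ ℕ→ℚ-injective (trans triple (sym pair)) ⟩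
      ∣ ⋂ (A ∷ B ∷ []) ∣        ≡⟨ cong ∣_∣ (⋂-pair A B) ⟩
      ∣ A ∩ B ∣                 ∎
      where
      open ≡-Reasoning
      triple : ℕ→ℚ ∣ ⋂ (A ∷ B ∷ C ∷ []) ∣ ≡ θ * ℕ→ℚ i
      triple = layer-⋂-card (s≤s (s≤s z≤n)) r≥3 (A ∷ B ∷ C ∷ [])
        ((A≢B ∷ (λ A≡C → C≢A (sym A≡C)) ∷ []) ∷ ((λ B≡C → C≢B (sym B≡C)) ∷ []) ∷ [] ∷ [])
        (A∈ ∷ B∈ ∷ C∈ ∷ [])
      pair : ℕ→ℚ ∣ ⋂ (A ∷ B ∷ []) ∣ ≡ θ * ℕ→ℚ i
      pair = layer-⋂-card (s≤s (s≤s z≤n)) (≤-trans (s≤s (s≤s z≤n)) r≥3) (A ∷ B ∷ [])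
        ((A≢B ∷ []) ∷ [] ∷ []) (A∈ ∷ B∈ ∷ [])

lemma2p8 : (n r : ℕ) (θ : ℚ) (F : List (Subset n)) →
           Unique F → r ≥ 3 → 0ℚ < θ → θ < 1ℚ →
           RClosedθIntersecting r θ F →
           (i : ℕ) → layer F i ≢ [] → Sunflower (layer F i)
lemma2p8 n r θ F _ r≥3 _ _ closed i _ =
  stableTripleIntersections⇒sunflower (layer F i)
    (layer-stableTripleIntersections {θ = θ} closed r≥3 i)
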